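{- Let $A$ and $B$ be finite totally ordered sets, $X$ the set of monotone non-decreasing maps $A\to B$, $Y$ the set of monotone non-decreasing maps $B\to A$, and $G(x,y)=\{(a,b)\in A\times B: x(a)=b,\ y(b)=a\}$. For any $x\in X$, $y\in Y$ and any $(a,b)\in G(x,y)$ there exists $x'\in X$ such that $G(x',y)=\{(a,b)\}$. -}

module Defs where

open import Data.Nat using (ℕ)
open import Data.Fin using (Fin; _≤_)
open import Data.Product using (_×_)
open import Relation.Binary.PropositionalEquality using (_≡_)

-- A finite totally ordered set of size m is (up to order-isomorphism) Fin m
-- with its standard order.

Monotone : {m n : ℕ} → (Fin m → Fin n) → Set
Monotone {m} f = ∀ (i j : Fin m) → i ≤ j → f i ≤ f j

InG : {m n : ℕ} → (Fin m → Fin n) → (Fin n → Fin m) → Fin m → Fin n → Set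
InG x y a b = (x a ≡ b) × (y b ≡ a)

module Submission where

open import Defs
open import Data.Nat using (ℕ)
open import Data.Fin using (Fin)
open import Data.Fin.Properties using (≤-refl)
open import Data.Product using (Σ; _×_; _,_)
open import Function using (const)
open import Relation.Binary.PropositionalEquality using (_≡_; refl; sym; trans)

-- The witness is the constant map at b: its graph meets the graph of y only at (y b , b).

const-monotone : {m n : ℕ} (b : Fin n) → Monotone {m} (const b)
const-monotone b _ _ _ = ≤-refl

InG-const⇒≡ : {m n : ℕ} {y : Fin n → Fin m} {a a′ : Fin m} {b b′ : Fin n} →
  y b ≡ a → InG (const b) y a′ b′ → (a′ ≡ a) × (b′ ≡ b)
InG-const⇒≡ yb≡a (refl , yb≡a′) = trans (sym yb≡a′) yb≡a , refl

≡⇒InG-const : {m n : ℕ} {y : Fin n → Fin m} {a a′ : Fin m} {b b′ : Fin n} →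
  y b ≡ a → (a′ ≡ a) × (b′ ≡ b) → InG (const b) y a′ b′
≡⇒InG-const yb≡a (refl , refl) = refl , yb≡a

proposition6 : (m n : ℕ) (x : Fin m → Fin n) (y : Fin n → Fin m) →
    Monotone x → Monotone y → (a : Fin m) (b : Fin n) → InG x y a b →
    Σ (Fin m → Fin n) (λ x′ → Monotone x′ ×
    ((a′ : Fin m) (b′ : Fin n) → (InG x′ y a′ b′ → (a′ ≡ a) × (b′ ≡ b)) × ((a′ ≡ a) × (b′ ≡ b) → InG x′ y a′ b′)))
proposition6 m n x y _ _ a b (_ , yb≡a) =
  const b , const-monotone b , λ _ _ → InG-const⇒≡ yb≡a , ≡⇒InG-const yb≡a
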